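{- Let $G$ be a finite simple graph, let $r\ge 1$, and let $H_1,\dots,H_r$ be Hamilton cycles in $G$ (viewed as spanning subgraphs on $V(G)$). Let $H=H_1\cup\dots\cup H_r$ be the graph on $V(G)$ with edge set $E(H_1)\cup\dots\cup E(H_r)$, and let $G-H$ be the graph on $V(G)$ with edge set $E(G)\setminus E(H)$. Then $\widetilde{\alpha}(G-H)+1\le (r+1)(\widetilde{\alpha}(G)+1)$.
   Context: For non-negative integers $s,t$, an $(s,t)$-bipartite-hole in a graph $F$ consists of two disjoint vertex sets $S,T$ with $|S|=s$, $|T|=t$ and no edge of $F$ between $S$ and $T$. The bipartite-hole-number $\widetilde{\alpha}(F)$ is the least integer $r$ which can be written as $r=s+t-1$ for some positive integers $s,t$ such that $F$ contains no $(s,t)$-bipartite-hole. -}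

module Defs where

open import Data.Nat using (ℕ; zero; suc; _+_; _*_; _∸_; _≤_)
open import Data.Fin using (Fin; toℕ)
open import Data.Fin.Subset using (Subset; _∈_; _∩_; ∣_∣; Empty)
open import Data.Bool using (Bool; true; false)
open import Data.Product using (Σ; ∃; ∃-syntax; _×_; _,_)
open import Data.Sum using (_⊎_)
open import Relation.Nullary using (¬_)
open import Relation.Binary.PropositionalEquality using (_≡_)
open import Function.Definitions using (Injective)

record SimpleGraph (n : ℕ) : Set where
  field
    adj   : Fin n → Fin n → Bool
    sym   : ∀ x y → adj x y ≡ adj y x
    irrefl : ∀ x → adj x x ≡ false

open SimpleGraph public

Edge : ∀ {n} → SimpleGraph n → Fin n → Fin n → Set
Edge G x y = adj G x y ≡ true

BipartiteHole : ∀ {n} → (Fin n → Fin n → Set) → ℕ → ℕ → Set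
BipartiteHole {n} E s t =
  Σ (Subset n) λ S → Σ (Subset n) λ T →
    Empty (S ∩ T) × ∣ S ∣ ≡ s × ∣ T ∣ ≡ t ×
    (∀ x y → x ∈ S → y ∈ T → ¬ E x y)

IsBipartiteHoleNumber : ∀ {n} → (Fin n → Fin n → Set) → ℕ → Set
IsBipartiteHoleNumber E r =
  (Σ ℕ λ s → Σ ℕ λ t → 1 ≤ s × 1 ≤ t × r ≡ s + t ∸ 1 × ¬ BipartiteHole E s t)
  × (∀ s t → 1 ≤ s → 1 ≤ t → ¬ BipartiteHole E s t → r ≤ s + t ∸ 1)

CyclicNext : ∀ {n} → Fin n → Fin n → Set
CyclicNext {n} i j = toℕ j ≡ suc (toℕ i) ⊎ (suc (toℕ i) ≡ n × toℕ j ≡ 0)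

record HamiltonCycle {n : ℕ} (G : SimpleGraph n) : Set where
  field
    three≤n : 3 ≤ n
    order   : Fin n → Fin n
    order-injective : Injective _≡_ _≡_ order
    inG     : ∀ i j → CyclicNext i j → Edge G (order i) (order j)

open HamiltonCycle public

CycleEdge : ∀ {n} {G : SimpleGraph n} → HamiltonCycle G → Fin n → Fin n → Set
CycleEdge C x y = ∃[ i ] ∃[ j ] CyclicNext i j ×
  ((x ≡ order C i × y ≡ order C j) ⊎ (x ≡ order C j × y ≡ order C i))

UnionEdge : ∀ {n r} {G : SimpleGraph n} → (Fin r → HamiltonCycle G) → Fin n → Fin n → Set
UnionEdge Hs x y = ∃[ k ] CycleEdge (Hs k) x y

MinusEdge : ∀ {n r} (G : SimpleGraph n) → (Fin r → HamiltonCycle G) → Fin n → Fin n → Set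
MinusEdge G Hs x y = Edge G x y × ¬ UnionEdge Hs x y

-- Write a = s + t ∸ 1 where G has no (s,t)-hole, with s ≤ t by symmetry.  Every vertex has
-- at most 2r neighbours in H = H₁ ∪ ⋯ ∪ Hᵣ, so if (S,T) were an (s, t + 2rs)-hole of G − H,
-- deleting the H-neighbourhood of S (at most 2rs vertices) from T would leave an (s,t)-hole
-- of G.  Hence b ≤ s + t + 2rs ∸ 1, and 2rs ≤ r(s + t) gives b + 1 ≤ (r + 1)(a + 1).

module Submission where

open import Defs
open import Data.Nat using (ℕ; zero; suc; _+_; _*_; _∸_; _≤_; z≤n; s≤s)
open import Data.Nat.Properties
  using (≤-trans; ≤-reflexive; ≤-total; +-comm; +-suc; *-suc; n≤1+n; m≤m+n;
         +-monoʳ-≤; +-mono-≤; *-monoʳ-≤; +-cancelʳ-≤)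
open import Data.Fin as Fin using (Fin; toℕ; _≟_)
open import Data.Fin.Properties using (any?; toℕ-injective; toℕ<n)
open import Data.Fin.Subset
  using (Subset; inside; outside; _∈_; _∉_; _⊆_; _∩_; _∪_; _─_; ⁅_⁆; ∣_∣; Empty)
  renaming (⊥ to ∅)
open import Data.Fin.Subset.Properties
  using (⊥⊆; ∣⊥∣≡0; x∈⁅x⁆; ∣⁅x⁆∣≡1; out⊆; s⊆s; p⊆p∪q; q⊆p∪q; x∈p∩q⁺; x∈p∩q⁻; ∩-comm; p─q⊆p)
open import Data.Vec using ([]; _∷_; here; there)
open import Data.Product using (∃-syntax; _×_; _,_)
open import Data.Sum using (_⊎_; inj₁; inj₂; [_,_]′)
open import Data.Empty using (⊥-elim)
open import Function using (_∘_; flip)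
open import Function.Definitions using (Injective)
open import Relation.Nullary using (¬_; yes; no; contradiction)
open import Relation.Nullary.Decidable using (_⊎-dec_; _×-dec_)
open import Relation.Binary.Definitions using (Decidable; Symmetric)
open import Relation.Binary.Rewriting using (Deterministic)
open import Relation.Binary.PropositionalEquality as ≡ using (_≡_; refl; cong; subst)
import Data.Nat.Properties as ℕₚ
open import Data.Nat.Tactic.RingSolver using (solve-∀)

∣p∪q∣≤∣p∣+∣q∣ : ∀ {n} (p q : Subset n) → ∣ p ∪ q ∣ ≤ ∣ p ∣ + ∣ q ∣
∣p∪q∣≤∣p∣+∣q∣ []            []            = z≤n
∣p∪q∣≤∣p∣+∣q∣ (outside ∷ p) (outside ∷ q) = ∣p∪q∣≤∣p∣+∣q∣ p q
∣p∪q∣≤∣p∣+∣q∣ (outside ∷ p) (inside  ∷ q) =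
  ≤-trans (s≤s (∣p∪q∣≤∣p∣+∣q∣ p q)) (≤-reflexive (≡.sym (+-suc ∣ p ∣ ∣ q ∣)))
∣p∪q∣≤∣p∣+∣q∣ (inside  ∷ p) (outside ∷ q) = s≤s (∣p∪q∣≤∣p∣+∣q∣ p q)
∣p∪q∣≤∣p∣+∣q∣ (inside  ∷ p) (inside  ∷ q) =
  s≤s (≤-trans (∣p∪q∣≤∣p∣+∣q∣ p q) (+-monoʳ-≤ ∣ p ∣ (n≤1+n ∣ q ∣)))

∣p∣≤∣p─q∣+∣q∣ : ∀ {n} (p q : Subset n) → ∣ p ∣ ≤ ∣ p ─ q ∣ + ∣ q ∣
∣p∣≤∣p─q∣+∣q∣ []            []            = z≤n
∣p∣≤∣p─q∣+∣q∣ (outside ∷ p) (outside ∷ q) = ∣p∣≤∣p─q∣+∣q∣ p q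
∣p∣≤∣p─q∣+∣q∣ (inside  ∷ p) (outside ∷ q) = s≤s (∣p∣≤∣p─q∣+∣q∣ p q)
∣p∣≤∣p─q∣+∣q∣ (outside ∷ p) (inside  ∷ q) =
  ≤-trans (∣p∣≤∣p─q∣+∣q∣ p q) (+-monoʳ-≤ ∣ p ─ q ∣ (n≤1+n ∣ q ∣))
∣p∣≤∣p─q∣+∣q∣ (inside  ∷ p) (inside  ∷ q) =
  ≤-trans (s≤s (∣p∣≤∣p─q∣+∣q∣ p q)) (≤-reflexive (≡.sym (+-suc ∣ p ─ q ∣ ∣ q ∣)))

x∈p─q⇒x∉q : ∀ {n} {x : Fin n} (p q : Subset n) → x ∈ p ─ q → x ∉ q
x∈p─q⇒x∉q (_ ∷ p) (outside ∷ q) (there x∈p─q) (there x∈q) = x∈p─q⇒x∉q p q x∈p─q x∈q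
x∈p─q⇒x∉q (_ ∷ p) (inside  ∷ q) (there x∈p─q) (there x∈q) = x∈p─q⇒x∉q p q x∈p─q x∈q

∃⊆-with-size : ∀ {n} t (p : Subset n) → t ≤ ∣ p ∣ → ∃[ q ] q ⊆ p × ∣ q ∣ ≡ t
∃⊆-with-size {n} zero p _ = ∅ , ⊥⊆ , ∣⊥∣≡0 n
∃⊆-with-size (suc t) (outside ∷ p) t<∣p∣ with ∃⊆-with-size (suc t) p t<∣p∣
... | q , q⊆p , ∣q∣≡1+t = outside ∷ q , out⊆ q⊆p , ∣q∣≡1+t
∃⊆-with-size (suc t) (inside  ∷ p) (s≤s t≤∣p∣) with ∃⊆-with-size t p t≤∣p∣
... | q , q⊆p , ∣q∣≡t = inside ∷ q , s⊆s q⊆p , cong suc ∣q∣≡t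

Empty-∩-⊆ : ∀ {n} {p q q′ : Subset n} → q′ ⊆ q → Empty (p ∩ q) → Empty (p ∩ q′)
Empty-∩-⊆ {p = p} {q′ = q′} q′⊆q p∩q≡∅ (x , x∈p∩q′) with x∈p∩q⁻ p q′ x∈p∩q′
... | x∈p , x∈q′ = p∩q≡∅ (x , x∈p∩q⁺ (x∈p , q′⊆q x∈q′))

-- E need not be decidable: each out-neighbourhood only has to lie in a subset of size ≤ d.
DegreeAtMost : ∀ {m n} → (Fin m → Fin n → Set) → ℕ → Set
DegreeAtMost E d = ∀ x → ∃[ N ] ∣ N ∣ ≤ d × (∀ {y} → E x y → y ∈ N)

DegreeAtMost-⇒ : ∀ {m n d} {E F : Fin m → Fin n → Set} →
  (∀ {x y} → E x y → F x y) → DegreeAtMost F d → DegreeAtMost E d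
DegreeAtMost-⇒ E⇒F degF x with degF x
... | N , ∣N∣≤d , covers = N , ∣N∣≤d , covers ∘ E⇒F

deterministic⇒DegreeAtMost1 : ∀ {m n} {R : Fin m → Fin n → Set} →
  Decidable R → Deterministic _≡_ R → DegreeAtMost R 1
deterministic⇒DegreeAtMost1 {n = n} R? det x with any? (R? x)
... | yes (y , Rxy) = ⁅ y ⁆ , ≤-reflexive (∣⁅x⁆∣≡1 y) ,
                      λ Rxy′ → subst (_∈ ⁅ y ⁆) (det Rxy Rxy′) (x∈⁅x⁆ y)
... | no ∄y        = ∅ , ≤-trans (≤-reflexive (∣⊥∣≡0 n)) z≤n , λ Rxy → contradiction (_ , Rxy) ∄y

DegreeAtMost-⊎ : ∀ {m n d e} {E F : Fin m → Fin n → Set} →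
  DegreeAtMost E d → DegreeAtMost F e → DegreeAtMost (λ x y → E x y ⊎ F x y) (d + e)
DegreeAtMost-⊎ {E = E} {F} degE degF x with degE x | degF x
... | N , ∣N∣≤d , coversE | M , ∣M∣≤e , coversF =
  N ∪ M , ≤-trans (∣p∪q∣≤∣p∣+∣q∣ N M) (+-mono-≤ ∣N∣≤d ∣M∣≤e) , covers
  where
  covers : ∀ {y} → E x y ⊎ F x y → y ∈ N ∪ M
  covers (inj₁ Exy) = p⊆p∪q M (coversE Exy)
  covers (inj₂ Fxy) = q⊆p∪q N M (coversF Fxy)

DegreeAtMost-⋃ : ∀ {m n d} r {E : Fin r → Fin m → Fin n → Set} →
  (∀ k → DegreeAtMost (E k) d) → DegreeAtMost (λ x y → ∃[ k ] E k x y) (r * d)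
DegreeAtMost-⋃ {n = n} zero    _   x = ∅ , ≤-reflexive (∣⊥∣≡0 n) , λ { (() , _) }
DegreeAtMost-⋃         (suc r) {E} deg =
  DegreeAtMost-⇒ split (DegreeAtMost-⊎ (deg Fin.zero) (DegreeAtMost-⋃ r (deg ∘ Fin.suc)))
  where
  split : ∀ {x y} → ∃[ k ] E k x y → E Fin.zero x y ⊎ ∃[ k ] E (Fin.suc k) x y
  split (Fin.zero  , e) = inj₁ e
  split (Fin.suc k , e) = inj₂ (k , e)

neighbourhood : ∀ {m n d} {E : Fin m → Fin n → Set} → DegreeAtMost E d → (S : Subset m) →
  ∃[ N ] ∣ N ∣ ≤ d * ∣ S ∣ × (∀ {x y} → x ∈ S → E x y → y ∈ N)
neighbourhood {n = n} deg [] = ∅ , ≤-trans (≤-reflexive (∣⊥∣≡0 n)) z≤n , λ ()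
neighbourhood deg (outside ∷ S) with neighbourhood (deg ∘ Fin.suc) S
... | N , ∣N∣≤ , covers = N , ∣N∣≤ , λ { (there x∈S) → covers x∈S }
neighbourhood {d = d} deg (inside ∷ S) with deg Fin.zero | neighbourhood (deg ∘ Fin.suc) S
... | N₀ , ∣N₀∣≤d , covers₀ | N , ∣N∣≤ , covers =
  N₀ ∪ N ,
  ≤-trans (∣p∪q∣≤∣p∣+∣q∣ N₀ N)
    (≤-trans (+-mono-≤ ∣N₀∣≤d ∣N∣≤) (≤-reflexive (≡.sym (*-suc d ∣ S ∣)))) ,
  λ { here e → p⊆p∪q N (covers₀ e) ; (there x∈S) e → q⊆p∪q N₀ N (covers x∈S e) }

Image : ∀ {m n} → (Fin m → Fin n) → (Fin m → Fin m → Set) → Fin n → Fin n → Set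
Image f R x y = ∃[ i ] ∃[ j ] R i j × x ≡ f i × y ≡ f j

Image-DegreeAtMost1 : ∀ {m n} {f : Fin m → Fin n} {R : Fin m → Fin m → Set} →
  Injective _≡_ _≡_ f → Decidable R → Deterministic _≡_ R → DegreeAtMost (Image f R) 1
Image-DegreeAtMost1 {f = f} {R} f-inj R? det = deterministic⇒DegreeAtMost1 image? image-det
  where
  image? : Decidable (Image f R)
  image? x y = any? λ i → any? λ j → R? i j ×-dec x ≟ f i ×-dec y ≟ f j

  image-det : Deterministic _≡_ (Image f R)
  image-det (i , j , Rij , x≡fi , y≡fj) (i′ , j′ , Ri′j′ , x≡fi′ , y′≡fj′)
    with f-inj (≡.trans (≡.sym x≡fi) x≡fi′)
  ... | refl = ≡.trans y≡fj (≡.trans (cong f (det Rij Ri′j′)) (≡.sym y′≡fj′))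

cyclicNext? : ∀ {n} → Decidable (CyclicNext {n})
cyclicNext? {n} i j = toℕ j ℕₚ.≟ suc (toℕ i) ⊎-dec (suc (toℕ i) ℕₚ.≟ n ×-dec toℕ j ℕₚ.≟ 0)

cyclicNext-deterministic : ∀ {n} → Deterministic _≡_ (CyclicNext {n})
cyclicNext-deterministic (inj₁ j≡1+i) (inj₁ j′≡1+i) =
  toℕ-injective (≡.trans j≡1+i (≡.sym j′≡1+i))
cyclicNext-deterministic {y = j} (inj₁ j≡1+i) (inj₂ (1+i≡n , _)) =
  ⊥-elim (ℕₚ.<-irrefl (≡.trans j≡1+i 1+i≡n) (toℕ<n j))
cyclicNext-deterministic {z = j′} (inj₂ (1+i≡n , _)) (inj₁ j′≡1+i) =
  ⊥-elim (ℕₚ.<-irrefl (≡.trans j′≡1+i 1+i≡n) (toℕ<n j′))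
cyclicNext-deterministic (inj₂ (_ , j≡0)) (inj₂ (_ , j′≡0)) = toℕ-injective (≡.trans j≡0 (≡.sym j′≡0))

cyclicNext-injective : ∀ {n} → Deterministic _≡_ (flip (CyclicNext {n}))
cyclicNext-injective (inj₁ j≡1+i) (inj₁ j≡1+i′) =
  toℕ-injective (ℕₚ.suc-injective (≡.trans (≡.sym j≡1+i) j≡1+i′))
cyclicNext-injective (inj₁ j≡1+i) (inj₂ (_ , j≡0)) with ≡.trans (≡.sym j≡1+i) j≡0
... | ()
cyclicNext-injective (inj₂ (_ , j≡0)) (inj₁ j≡1+i′) with ≡.trans (≡.sym j≡1+i′) j≡0
... | ()
cyclicNext-injective (inj₂ (1+i≡n , _)) (inj₂ (1+i′≡n , _)) =
  toℕ-injective (ℕₚ.suc-injective (≡.trans 1+i≡n (≡.sym 1+i′≡n)))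

CycleEdge-DegreeAtMost2 : ∀ {n} {G : SimpleGraph n} (C : HamiltonCycle G) → DegreeAtMost (CycleEdge C) 2
CycleEdge-DegreeAtMost2 C = DegreeAtMost-⇒ forward-or-backward
  (DegreeAtMost-⊎ (Image-DegreeAtMost1 (order-injective C) cyclicNext? cyclicNext-deterministic)
                  (Image-DegreeAtMost1 (order-injective C) (flip cyclicNext?) cyclicNext-injective))
  where
  forward-or-backward : ∀ {x y} → CycleEdge C x y →
    Image (order C) CyclicNext x y ⊎ Image (order C) (flip CyclicNext) x y
  forward-or-backward (i , j , i→j , inj₁ (x≡oi , y≡oj)) = inj₁ (i , j , i→j , x≡oi , y≡oj)
  forward-or-backward (i , j , i→j , inj₂ (x≡oj , y≡oi)) = inj₂ (j , i , i→j , x≡oj , y≡oi)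

UnionEdge-DegreeAtMost : ∀ {n r} {G : SimpleGraph n} (Hs : Fin r → HamiltonCycle G) →
  DegreeAtMost (UnionEdge Hs) (r * 2)
UnionEdge-DegreeAtMost {r = r} Hs = DegreeAtMost-⋃ r (CycleEdge-DegreeAtMost2 ∘ Hs)

BipartiteHole-swap : ∀ {n s t} {E : Fin n → Fin n → Set} →
  Symmetric E → BipartiteHole E s t → BipartiteHole E t s
BipartiteHole-swap E-sym (S , T , S∩T≡∅ , ∣S∣≡s , ∣T∣≡t , no-edge) =
  T , S , subst Empty (∩-comm S T) S∩T≡∅ , ∣T∣≡t , ∣S∣≡s ,
  λ x y x∈T y∈S Exy → no-edge y x y∈S x∈T (E-sym Exy)

¬BipartiteHole-deletion : ∀ {n d s t} {E E′ F : Fin n → Fin n → Set} → DegreeAtMost F d →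
  (∀ {x y} → E x y → ¬ F x y → E′ x y) →
  ¬ BipartiteHole E s t → ¬ BipartiteHole E′ s (t + d * s)
¬BipartiteHole-deletion {d = d} {s} {t} {E} degF keep no-E-hole
  (S , T , S∩T≡∅ , ∣S∣≡s , ∣T∣≡t+ds , no-E′-edge)
  with neighbourhood degF S
... | N , ∣N∣≤d∣S∣ , N-covers with ∃⊆-with-size t (T ─ N) t≤∣T─N∣
  where
  t≤∣T─N∣ : t ≤ ∣ T ─ N ∣
  t≤∣T─N∣ = +-cancelʳ-≤ (d * s) t ∣ T ─ N ∣ (begin
    t + d * s          ≡⟨ ≡.sym ∣T∣≡t+ds ⟩
    ∣ T ∣              ≤⟨ ∣p∣≤∣p─q∣+∣q∣ T N ⟩
    ∣ T ─ N ∣ + ∣ N ∣  ≤⟨ +-monoʳ-≤ ∣ T ─ N ∣ (subst (λ k → ∣ N ∣ ≤ d * k) ∣S∣≡s ∣N∣≤d∣S∣) ⟩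
    ∣ T ─ N ∣ + d * s  ∎)
    where open ℕₚ.≤-Reasoning
... | T′ , T′⊆T─N , ∣T′∣≡t =
  no-E-hole (S , T′ , Empty-∩-⊆ (p─q⊆p T N ∘ T′⊆T─N) S∩T≡∅ , ∣S∣≡s , ∣T′∣≡t , no-E-edge)
  where
  no-E-edge : ∀ x y → x ∈ S → y ∈ T′ → ¬ E x y
  no-E-edge x y x∈S y∈T′ Exy = no-E′-edge x y x∈S (p─q⊆p T N y∈T─N)
    (keep Exy (x∈p─q⇒x∉q T N y∈T─N ∘ N-covers x∈S))
    where y∈T─N = T′⊆T─N y∈T′

deletion-arithmetic : ∀ r u v → u ≤ v → u + (v + r * 2 * u) ≤ (r + 1) * (u + v)
deletion-arithmetic r u v u≤v = begin
  u + (v + r * 2 * u)    ≡⟨ regroup r u v ⟩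
  (u + v) + r * (u + u)  ≤⟨ +-monoʳ-≤ (u + v) (*-monoʳ-≤ r (+-monoʳ-≤ u u≤v)) ⟩
  (u + v) + r * (u + v)  ≡⟨ collect r u v ⟩
  (r + 1) * (u + v)      ∎
  where
  open ℕₚ.≤-Reasoning
  regroup : ∀ r u v → u + (v + r * 2 * u) ≡ (u + v) + r * (u + u)
  regroup = solve-∀
  collect : ∀ r u v → (u + v) + r * (u + v) ≡ (r + 1) * (u + v)
  collect = solve-∀

IsBipartiteHoleNumber-deletion : ∀ {n r a b} {E E′ F : Fin n → Fin n → Set} →
  Symmetric E → DegreeAtMost F (r * 2) → (∀ {x y} → E x y → ¬ F x y → E′ x y) →
  IsBipartiteHoleNumber E a → IsBipartiteHoleNumber E′ b → b + 1 ≤ (r + 1) * (a + 1)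
IsBipartiteHoleNumber-deletion {r = r} {a} {b} {E} E-sym degF keep
  ((s , t , 1≤s , 1≤t , a≡s+t-1 , no-hole) , _) (_ , b-least) =
  [ (λ s≤t → bound s t 1≤s s≤t a≡s+t-1 no-hole)
  , (λ t≤s → bound t s 1≤t t≤s (≡.trans a≡s+t-1 (cong (_∸ 1) (+-comm s t)))
                   (no-hole ∘ BipartiteHole-swap E-sym))
  ]′ (≤-total s t)
  where
  bound : ∀ u v → 1 ≤ u → u ≤ v → a ≡ u + v ∸ 1 → ¬ BipartiteHole E u v → b + 1 ≤ (r + 1) * (a + 1)
  bound (suc u) v _ 1+u≤v a≡u+v no-hole′ = begin
    b + 1                            ≡⟨ +-comm b 1 ⟩
    suc b                            ≤⟨ s≤s (b-least (suc u) (v + r * 2 * suc u) (s≤s z≤n) 1≤v+2r[1+u]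
                                              (¬BipartiteHole-deletion degF keep no-hole′)) ⟩
    suc u + (v + r * 2 * suc u)      ≤⟨ deletion-arithmetic r (suc u) v 1+u≤v ⟩
    (r + 1) * (suc u + v)            ≡⟨ cong ((r + 1) *_) (≡.trans (cong suc (≡.sym a≡u+v)) (+-comm 1 a)) ⟩
    (r + 1) * (a + 1)                ∎
    where
    open ℕₚ.≤-Reasoning
    1≤v+2r[1+u] : 1 ≤ v + r * 2 * suc u
    1≤v+2r[1+u] = ≤-trans (≤-trans (s≤s z≤n) 1+u≤v) (m≤m+n v _)

Edge-symmetric : ∀ {n} (G : SimpleGraph n) → Symmetric (Edge G)
Edge-symmetric G {x} {y} Gxy = ≡.trans (SimpleGraph.sym G y x) Gxy

lemma2 : (n : ℕ) (G : SimpleGraph n) (r : ℕ) → 1 ≤ r →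
    (Hs : Fin r → HamiltonCycle G) → (a b : ℕ) →
    IsBipartiteHoleNumber (Edge G) a →
    IsBipartiteHoleNumber (MinusEdge G Hs) b →
    b + 1 ≤ (r + 1) * (a + 1)
lemma2 n G r _ Hs a b =
  IsBipartiteHoleNumber-deletion {r = r} (Edge-symmetric G) (UnionEdge-DegreeAtMost Hs) _,_
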